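{- If $\mathcal{V}$ is a p-point on $\omega$ with $\mathcal{V}\ge_T\omega^\omega$ and $\mathcal{U}$ is any ultrafilter on $\omega$, then $\mathcal{U}\cdot\mathcal{V}\equiv_T\mathcal{U}\times\mathcal{V}$.
   Context: Ultrafilters are ordered by $\supseteq$, $\omega^\omega$ by pointwise $\le$, and $\mathcal{U}\times\mathcal{V}$ by the coordinatewise order. $D\le_T E$ means there is a map $E\to D$ sending cofinal subsets to cofinal subsets; $\equiv_T$ means reducibility in both directions. $\mathcal{U}\cdot\mathcal{V}=\{A\subseteq\omega\times\omega:\{i:\{j:(i,j)\in A\}\in\mathcal{V}\}\in\mathcal{U}\}$. A p-point is a nonprincipal ultrafilter on $\omega$ in which every countable subfamily $\{X_n\}$ has some $X$ in the ultrafilter with $X\setminus X_n$ finite for all $n$. -}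

module Defs where

open import Level using (0ℓ)
open import Data.Nat using (ℕ; _≤_; _<_)
open import Data.Product using (Σ; ∃; _×_; _,_; proj₁; proj₂)
open import Data.Sum using (_⊎_)
open import Data.Empty using (⊥)
open import Relation.Nullary using (¬_)
open import Relation.Unary using (Pred; _⊆_; ∁; _∩_; U; ∅)
open import Relation.Binary.PropositionalEquality using (_≡_)

Subset : Set → Set₁
Subset A = Pred A 0ℓ

record IsUltrafilter (F : Subset ℕ → Set) : Set₁ where
  field
    full     : F U
    no-empty : ¬ F ∅
    upward   : ∀ {A B : Subset ℕ} → A ⊆ B → F A → F B
    meet     : ∀ {A B : Subset ℕ} → F A → F B → F (A ∩ B)
    ultra    : ∀ (A : Subset ℕ) → F A ⊎ F (∁ A)

Nonprincipal : (Subset ℕ → Set) → Set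
Nonprincipal F = ∀ (n : ℕ) → ¬ F (λ m → m ≡ n)

FiniteSet : Subset ℕ → Set
FiniteSet X = ∃ λ (N : ℕ) → ∀ m → X m → m < N

_∖_ : Subset ℕ → Subset ℕ → Subset ℕ
(X ∖ Y) m = X m × ¬ Y m

record IsPPoint (F : Subset ℕ → Set) : Set₁ where
  field
    ultrafilter  : IsUltrafilter F
    nonprincipal : Nonprincipal F
    pseudoint    : ∀ (Xs : ℕ → Subset ℕ) → (∀ n → F (Xs n)) →
                   ∃ λ (X : Subset ℕ) → F X × (∀ n → FiniteSet (X ∖ Xs n))

record Poset : Set₂ where
  field
    Carrier : Set₁
    _≼_     : Carrier → Carrier → Set

open Poset public

Cofinal : (P : Poset) → Pred (Carrier P) 0ℓ → Set₁
Cofinal P X = ∀ (d : Carrier P) → ∃ λ (x : Carrier P) → X x × _≼_ P d x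

-- D ≤_T E: a map E → D sending cofinal subsets to cofinal subsets.
-- (The image f[X] is cofinal in D iff every d is below some f x with x ∈ X.)
_≤T_ : Poset → Poset → Set₁
D ≤T E = Σ (Carrier E → Carrier D) λ f →
  ∀ (X : Pred (Carrier E) 0ℓ) → Cofinal E X →
    ∀ (d : Carrier D) → ∃ λ (e : Carrier E) → X e × _≼_ D d (f e)

_≡T_ : Poset → Poset → Set₁
D ≡T E = (D ≤T E) × (E ≤T D)

Baire : Poset
Baire = record { Carrier = Level.Lift _ (ℕ → ℕ)
               ; _≼_ = λ f g → ∀ n → Level.Lift.lower f n ≤ Level.Lift.lower g n }

UF : (Subset ℕ → Set) → Poset
UF F = record { Carrier = Σ (Subset ℕ) F
              ; _≼_ = λ A B → proj₁ B ⊆ proj₁ A }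

_⊗_ : Poset → Poset → Poset
P ⊗ Q = record { Carrier = Carrier P × Carrier Q
               ; _≼_ = λ x y → _≼_ P (proj₁ x) (proj₁ y) × _≼_ Q (proj₂ x) (proj₂ y) }

FubiniSet : (Subset ℕ → Set) → (Subset ℕ → Set) → Subset (ℕ × ℕ) → Set
FubiniSet F G A = F (λ i → G (λ j → A (i , j)))

Fubini : (Subset ℕ → Set) → (Subset ℕ → Set) → Poset
Fubini F G = record { Carrier = Σ (Subset (ℕ × ℕ)) (FubiniSet F G)
                    ; _≼_ = λ A B → proj₁ B ⊆ proj₁ A }

-- Classical metatheory (the paper works in ZFC).
ExcludedMiddle : Set₁
ExcludedMiddle = ∀ (P : Set) → P ⊎ ¬ P

module Submission where

-- 𝒰 × 𝒱 ≤T 𝒰·𝒱: send A to (its 𝒱-large rows, the union of those rows).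
-- This map is convergent (everything inside the rectangle B × C lands
-- below (B , C)), and convergent maps are Tukey.
--
-- 𝒰·𝒱 ≤T 𝒰 × 𝒱: send (B , C) to the part of B × C strictly above the graph
-- of φ(C).  Given A ∈ 𝒰·𝒱, the p-point property yields C₀ ∈ 𝒱 and g with
-- C₀ ∩ [g i, ∞) ⊆ Aᵢ for every 𝒱-large row i.  A Tukey map into ω^ω must
-- dominate g somewhere on every cofinal family; applied to a cofinal family
-- of elements of the given cofinal set lying below (large rows of A , C₀),
-- this gives one whose image lies inside A.

open import Defs
open import Level using (lift; lower)
open import Data.Nat using (ℕ; zero; suc; _≤_; _<_; z≤n)
open import Data.Nat.Properties using (≤∧≢⇒<; ≤-trans; <⇒≤; <⇒≱)
open import Data.Bool using (Bool; T)
open import Data.Product using (Σ; ∃; _×_; _,_; proj₁; proj₂)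
open import Data.Sum using (inj₁; inj₂)
open import Data.Empty using (⊥-elim)
open import Relation.Nullary using (¬_; Dec)
open import Relation.Nullary.Decidable using (⌊_⌋; fromSum; toWitness; fromWitness)
open import Relation.Unary using (_⊆_; _∩_)
open import Relation.Binary.PropositionalEquality using (_≡_; sym)

row : Subset (ℕ × ℕ) → ℕ → Subset ℕ
row A i j = A (i , j)

largeRows : (Subset ℕ → Set) → Subset (ℕ × ℕ) → Subset ℕ
largeRows F A i = F (row A i)

unionLargeRows : (Subset ℕ → Set) → Subset (ℕ × ℕ) → Subset ℕ
unionLargeRows F A j = Σ ℕ λ i → largeRows F A i × A (i , j)

rectangle : Subset ℕ → Subset ℕ → Subset (ℕ × ℕ)
rectangle B C (i , j) = B i × C j

aboveGraph : Subset ℕ → Subset ℕ → (ℕ → ℕ) → Subset (ℕ × ℕ)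
aboveGraph B C f (i , j) = B i × C j × f i < j

-- Subsets of ℕ given by a Boolean characteristic function.  The members of
-- F of this form are indexed by a small type (a Set), unlike F itself.
decode : (ℕ → Bool) → Subset ℕ
decode b m = T (b m)

Coded : (Subset ℕ → Set) → Set
Coded F = Σ (ℕ → Bool) λ b → F (decode b)

module UltrafilterFacts (em : ExcludedMiddle) {F : Subset ℕ → Set}
                        (uf : IsUltrafilter F) where
  open IsUltrafilter uf

  witness : ∀ {A : Subset ℕ} → F A → Σ ℕ A
  witness {A} A∈ with em (Σ ℕ A)
  ... | inj₁ w  = w
  ... | inj₂ ¬w = ⊥-elim (no-empty (upward (λ {m} a → ¬w (m , a)) A∈))

  guarded : (Q : Set) {A : Subset ℕ} → (Q → F A) → F (λ j → Q → A j)
  guarded Q Q→A∈ with em Q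
  ... | inj₁ q  = upward (λ a _ → a) (Q→A∈ q)
  ... | inj₂ ¬q = upward (λ _ q → ⊥-elim (¬q q)) full

  codeBelow : ∀ {D : Subset ℕ} → F D → Σ (Coded F) λ c → decode (proj₁ c) ⊆ D
  codeBelow {D} D∈ = (b , upward (fromWitness {a? = dec _}) D∈) , toWitness {a? = dec _}
    where
    dec : ∀ m → Dec (D m)
    dec m = fromSum (em (D m))
    b : ℕ → Bool
    b m = ⌊ dec m ⌋

  module _ (np : Nonprincipal F) where
    avoid : ∀ n → F (λ m → ¬ m ≡ n)
    avoid n with ultra (λ m → m ≡ n)
    ... | inj₁ single∈ = ⊥-elim (np n single∈)
    ... | inj₂ avoid∈  = avoid∈

    finalSegment : ∀ n → F (λ j → n < j)
    finalSegment zero    = upward (λ j≢0 → ≤∧≢⇒< z≤n (λ e → j≢0 (sym e))) (avoid 0)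
    finalSegment (suc n) = upward (λ (n<j , j≢n+1) → ≤∧≢⇒< n<j (λ e → j≢n+1 (sym e)))
                                  (meet (finalSegment n) (avoid (suc n)))

module PPointFacts (em : ExcludedMiddle) {F : Subset ℕ → Set} (pp : IsPPoint F) where
  open IsPPoint pp
  open UltrafilterFacts em ultrafilter using (guarded)

  boundedPseudointersection : (Xs : ℕ → Subset ℕ) → (∀ n → F (Xs n)) →
    Σ (Subset ℕ) λ C → Σ (ℕ → ℕ) λ g → F C × (∀ n {j} → C j → g n ≤ j → Xs n j)
  boundedPseudointersection Xs Xs∈ with pseudoint Xs Xs∈
  ... | C , C∈ , finite = C , g , C∈ , inside
    where
    g : ℕ → ℕ
    g n = proj₁ (finite n)
    inside : ∀ n {j} → C j → g n ≤ j → Xs n j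
    inside n {j} Cj gn≤j with em (Xs n j)
    ... | inj₁ x  = x
    ... | inj₂ ¬x = ⊥-elim (<⇒≱ (proj₂ (finite n) j (Cj , ¬x)) gn≤j)

  uniformRows : (A : Subset (ℕ × ℕ)) → Σ (Subset ℕ) λ C → Σ (ℕ → ℕ) λ g →
    F C × (∀ {i j} → largeRows F A i → C j → g i ≤ j → A (i , j))
  uniformRows A with boundedPseudointersection (λ i j → largeRows F A i → A (i , j))
                                               (λ i → guarded (largeRows F A i) (λ a → a))
  ... | C , g , C∈ , inside = C , g , C∈ , λ {i} i∈ Cj gi≤j → inside i Cj gi≤j i∈

convergent⇒≤T : {D E : Poset} (f : Carrier E → Carrier D) →
  (∀ d → ∃ λ e₀ → ∀ e → _≼_ E e₀ e → _≼_ D d (f e)) → D ≤T E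
convergent⇒≤T f convergent = f , λ X cofinal d →
  let e₀ , below = convergent d
      e , Xe , e₀≼e = cofinal e₀
  in e , Xe , below e e₀≼e

-- A Tukey map φ : E → ω^ω dominates every g at some point of any cofinal
-- family k indexed by a small type I.  (Otherwise the points where φ does
-- not dominate g would form a cofinal set whose image misses g.)
dominatesOnCofinal : ExcludedMiddle → {E : Poset} ((φ , _) : Baire ≤T E) →
  {I : Set} (k : I → Carrier E) → (∀ e → ∃ λ i → _≼_ E e (k i)) →
  (g : ℕ → ℕ) → ∃ λ i → ∀ n → g n ≤ lower (φ (k i)) n
dominatesOnCofinal em {E} (φ , tukey) k cofinal g with em (∃ λ i → ∀ n → g n ≤ lower (φ (k i)) n)
... | inj₁ found   = found
... | inj₂ ¬found =
  let _ , notDominating , dominating = tukey NotDominating notDominatingCofinal (lift g)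
  in ⊥-elim (notDominating dominating)
  where
  NotDominating : Carrier E → Set
  NotDominating e = ¬ (∀ n → g n ≤ lower (φ e) n)
  notDominatingCofinal : Cofinal E NotDominating
  notDominatingCofinal e = let i , e≼ki = cofinal e in k i , (λ dom → ¬found (i , dom)) , e≼ki

module Reductions (em : ExcludedMiddle) (𝒰 𝒱 : Subset ℕ → Set) (pp : IsPPoint 𝒱)
                  (φ≤T : Baire ≤T UF 𝒱) (𝒰-uf : IsUltrafilter 𝒰) where
  open IsPPoint pp using (ultrafilter; nonprincipal)
  module U = IsUltrafilter 𝒰-uf
  module V = IsUltrafilter ultrafilter
  open UltrafilterFacts em 𝒰-uf using () renaming (witness to 𝒰-witness)
  open UltrafilterFacts em ultrafilter using (witness; codeBelow; finalSegment)
  open PPointFacts em pp using (uniformRows)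

  rowsMap : Carrier (Fubini 𝒰 𝒱) → Carrier (UF 𝒰 ⊗ UF 𝒱)
  rowsMap (A , A∈) = (largeRows 𝒱 A , A∈) , (unionLargeRows 𝒱 A , union∈)
    where
    union∈ : 𝒱 (unionLargeRows 𝒱 A)
    union∈ = let i , i∈ = 𝒰-witness A∈ in V.upward (λ a → i , i∈ , a) i∈

  -- Any A inside the rectangle B × C is sent below (B , C): its large rows
  -- are nonempty, hence in B, and all its points have second coordinate in C.
  rowsMap-convergent : ∀ d → ∃ λ e₀ → ∀ e → _≼_ (Fubini 𝒰 𝒱) e₀ e →
    _≼_ (UF 𝒰 ⊗ UF 𝒱) d (rowsMap e)
  rowsMap-convergent ((B , B∈) , (C , C∈)) = (rectangle B C , rectangle∈) , λ _ A⊆ →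
    (λ i∈ → proj₁ (A⊆ (proj₂ (witness i∈)))) , (λ (_ , _ , a) → proj₂ (A⊆ a))
    where
    rectangle∈ : FubiniSet 𝒰 𝒱 (rectangle B C)
    rectangle∈ = U.upward (λ Bi → V.upward (λ Cj → Bi , Cj) C∈) B∈

  product≤Fubini : (UF 𝒰 ⊗ UF 𝒱) ≤T Fubini 𝒰 𝒱
  product≤Fubini = convergent⇒≤T {UF 𝒰 ⊗ UF 𝒱} {Fubini 𝒰 𝒱} rowsMap rowsMap-convergent

  φ : Carrier (UF 𝒱) → ℕ → ℕ
  φ C = lower (proj₁ φ≤T C)

  graphMap : Carrier (UF 𝒰 ⊗ UF 𝒱) → Carrier (Fubini 𝒰 𝒱)
  graphMap ((B , B∈) , C) = aboveGraph B (proj₁ C) (φ C) , above∈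
    where
    above∈ : FubiniSet 𝒰 𝒱 (aboveGraph B (proj₁ C) (φ C))
    above∈ = U.upward (λ {i} Bi → V.upward (λ (Cj , lt) → Bi , Cj , lt)
                                       (V.meet (proj₂ C) (finalSegment nonprincipal (φ C i))))
                      B∈

  graphMap-inside : ∀ {A : Subset (ℕ × ℕ)} {C₀ : Subset ℕ} {g : ℕ → ℕ} →
    (∀ {i j} → largeRows 𝒱 A i → C₀ j → g i ≤ j → A (i , j)) →
    ∀ e → proj₁ (proj₁ e) ⊆ largeRows 𝒱 A → proj₁ (proj₂ e) ⊆ C₀ →
    (∀ n → g n ≤ φ (proj₂ e) n) → proj₁ (graphMap e) ⊆ A
  graphMap-inside uniform ((B , B∈) , C) B⊆ C⊆ dominating {i , j} (Bi , Cj , φi<j) =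
    uniform (B⊆ Bi) (C⊆ Cj) (≤-trans (dominating i) (<⇒≤ φi<j))

  -- Every cofinal X contains a point whose image lies inside a given A ∈ 𝒰·𝒱:
  -- below (large rows of A , D ∩ C₀) for each coded D ∈ 𝒱 pick a point of X;
  -- their second coordinates are cofinal in 𝒱, so φ dominates g at one of them.
  graphMap-tukey : ∀ X → Cofinal (UF 𝒰 ⊗ UF 𝒱) X →
    ∀ A → ∃ λ e → X e × proj₁ (graphMap e) ⊆ proj₁ A
  graphMap-tukey X cofinal (A , A∈) with uniformRows A
  ... | C₀ , g , C₀∈ , uniform =
    pick c , X-pick , graphMap-inside uniform (pick c) B⊆ C⊆ dominating
    where
    target : Coded 𝒱 → Carrier (UF 𝒰 ⊗ UF 𝒱)
    target (b , b∈) = (largeRows 𝒱 A , A∈) , (decode b ∩ C₀ , V.meet b∈ C₀∈)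
    chosen : ∀ c → ∃ λ e → X e × _≼_ (UF 𝒰 ⊗ UF 𝒱) (target c) e
    chosen c = cofinal (target c)
    pick : Coded 𝒱 → Carrier (UF 𝒰 ⊗ UF 𝒱)
    pick c = proj₁ (chosen c)
    picked-cofinal : ∀ D → ∃ λ c → _≼_ (UF 𝒱) D (proj₂ (pick c))
    picked-cofinal (D , D∈) =
      let c , c⊆D = codeBelow D∈ in
      c , λ Dj → c⊆D (proj₁ (proj₂ (proj₂ (proj₂ (chosen c))) Dj))
    found : ∃ λ c → ∀ n → g n ≤ φ (proj₂ (pick c)) n
    found = dominatesOnCofinal em φ≤T (λ c → proj₂ (pick c)) picked-cofinal g
    c : Coded 𝒱
    c = proj₁ found
    dominating : ∀ n → g n ≤ φ (proj₂ (pick c)) n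
    dominating = proj₂ found
    X-pick : X (pick c)
    X-pick = proj₁ (proj₂ (chosen c))
    B⊆ : proj₁ (proj₁ (pick c)) ⊆ largeRows 𝒱 A
    B⊆ = proj₁ (proj₂ (proj₂ (chosen c)))
    C⊆ : proj₁ (proj₂ (pick c)) ⊆ C₀
    C⊆ Cj = proj₂ (proj₂ (proj₂ (proj₂ (chosen c))) Cj)

  Fubini≤product : Fubini 𝒰 𝒱 ≤T (UF 𝒰 ⊗ UF 𝒱)
  Fubini≤product = graphMap , graphMap-tukey

corollary34 : ExcludedMiddle →
    (𝒰 𝒱 : Subset ℕ → Set) → IsPPoint 𝒱 → Baire ≤T UF 𝒱 → IsUltrafilter 𝒰 →
    Fubini 𝒰 𝒱 ≡T (UF 𝒰 ⊗ UF 𝒱)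
corollary34 em 𝒰 𝒱 pp φ≤T 𝒰-uf = Fubini≤product , product≤Fubini
  where open Reductions em 𝒰 𝒱 pp φ≤T 𝒰-uf
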